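{- Let $\lambda$ be a nonempty partition. Then $N(\mathcal{L}(\lambda))=N(\mathcal{D}(\lambda))+\mathrm{Leaves}(\mathcal{L}(\lambda))$, where $N(\cdot)$ is the number of nodes and $\mathrm{Leaves}(\cdot)$ the number of leaves of the game tree.
   Context: For a partition $\mu=(\mu_1,\dots,\mu_s)$ and nonnegative integers $i,j$, $\mu[i,j]$ is $(\mu_{i+1}-j,\mu_{i+2}-j,\dots)$ with nonpositive entries removed, if $i<s$ and $j<\mu_{i+1}$; otherwise $\mu[i,j]=()$. LCTR $\mathcal{L}(\lambda)$: from a nonempty $\mu$ one moves to $\mu[1,0]$ or $\mu[0,1]$ (two distinct moves, even if they lead to the same partition); $()$ is terminal. Downright $\mathcal{D}(\lambda)$ (nonempty $\lambda$): from $\mu=(\mu_1,\dots,\mu_s)$ one may move to $\mu[1,0]$ if $s>1$ and to $\mu[0,1]$ if $\mu_1>1$. The game tree $T_p$ of a game at position $p$ is the rooted tree with root $p$ and, for each move $p\to\tilde p$, an edge from $p$ to the root of a copy of $T_{\tilde p}$; nodes and leaves are counted in this tree (so a position reachable in several ways is counted with multiplicity). -}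

module Defs where

open import Data.Nat using (ℕ; zero; suc; _+_; _∸_; _≤_; _<_; _<ᵇ_)
open import Data.Bool using (Bool; true; false; if_then_else_; _∧_)
open import Data.List using (List; []; _∷_; length; drop; map; filterᵇ; _++_)
open import Data.Nat.ListAction using (sum)
open import Data.Product using (_×_)
open import Data.List.Relation.Unary.All using (All)
open import Data.List.Relation.Unary.Linked using (Linked)
open import Data.Maybe using (Maybe; just; nothing)
open import Relation.Binary.PropositionalEquality using (_≡_)

Partition : Set
Partition = List ℕ

IsPartition : Partition → Set
IsPartition μ = All (λ x → 1 ≤ x) μ × Linked (λ a b → b ≤ a) μ

-- (i+1)-th part μ_{i+1} (0-indexed access), if it exists
part : Partition → ℕ → Maybe ℕ
part []      _       = nothing
part (x ∷ μ) zero    = just x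
part (x ∷ μ) (suc i) = part μ i

-- μ[i,j] = (μ_{i+1} - j, μ_{i+2} - j, ...) with nonpositive entries removed,
-- if i < s and j < μ_{i+1}; otherwise ().
shift : Partition → ℕ → ℕ → Partition
shift μ i j with part μ i
... | nothing = []
... | just m  = if j <ᵇ m
                then filterᵇ (λ x → 0 <ᵇ x) (map (λ x → x ∸ j) (drop i μ))
                else []

data Tree : Set where
  node : List Tree → Tree

mutual
  nodes : Tree → ℕ
  nodes (node ts) = suc (nodesList ts)

  nodesList : List Tree → ℕ
  nodesList []       = 0
  nodesList (t ∷ ts) = nodes t + nodesList ts

mutual
  leaves : Tree → ℕ
  leaves (node [])       = 1
  leaves (node (t ∷ ts)) = leavesList (t ∷ ts)

  leavesList : List Tree → ℕ
  leavesList []       = 0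
  leavesList (t ∷ ts) = leaves t + leavesList ts

-- Every move from a nonempty
-- partition strictly decreases the sum of parts, so fuel = 1 + sum λ is
-- always enough: the fuel never runs out before a terminal position.

lctrTreeF : ℕ → Partition → Tree
lctrTreeF zero    _       = node []
lctrTreeF (suc n) []      = node []
lctrTreeF (suc n) (x ∷ μ) =
  node (lctrTreeF n (shift (x ∷ μ) 1 0) ∷ lctrTreeF n (shift (x ∷ μ) 0 1) ∷ [])

lctrTree : Partition → Tree
lctrTree λ' = lctrTreeF (suc (sum λ')) λ'

downrightTreeF : ℕ → Partition → Tree
downrightTreeF zero    _       = node []
downrightTreeF (suc n) []      = node []
downrightTreeF (suc n) (x ∷ μ) =
  node ((if 1 <ᵇ length (x ∷ μ) then downrightTreeF n (shift (x ∷ μ) 1 0) ∷ [] else [])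
        ++
        (if 1 <ᵇ x then downrightTreeF n (shift (x ∷ μ) 0 1) ∷ [] else []))

downrightTree : Partition → Tree
downrightTree λ' = downrightTreeF (suc (sum λ')) λ'

-- Every move of LCTR to a nonempty position is also a Downright move, and the only
-- LCTR moves Downright forbids are those to the terminal position (): μ[1,0] = ()
-- exactly when s = 1, and μ[0,1] = () exactly when μ₁ = 1.  So the Downright tree
-- is the LCTR tree with its leaves cut off, and every node of the LCTR tree is
-- either a leaf or a node of the Downright tree.
module Submission where

open import Defs
open import Data.Nat using (_+_)
open import Data.List using ([])
open import Relation.Binary.PropositionalEquality using (_≡_; _≢_)

open import Data.Bool using (Bool; true; false; if_then_else_)
open import Data.Bool.Properties using (T?)
open import Data.Maybe using (just; nothing)
open import Data.Empty using (⊥-elim)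
open import Data.List using (List; _∷_; _++_; map; filterᵇ; length; drop)
open import Data.List.Properties using (filter-all; ++-identityʳ; map-id)
open import Data.List.Relation.Unary.All as All using (All; _∷_)
open import Data.List.Relation.Unary.All.Properties using (all-filter)
open import Data.Nat using (ℕ; zero; suc; _∸_; _≤_; _<_; _<ᵇ_; z≤n; s≤s)
open import Data.Nat.ListAction using (sum)
open import Data.Nat.Properties
  using ( ≤-trans; <-≤-trans; +-mono-≤; +-monoʳ-≤
        ; m≤n+m; m<n+m; n<1+n; m∸n≤m; +-identityʳ; +-assoc; <ᵇ⇒<; <⇒<ᵇ
        ; +-commutativeSemigroup)
open import Data.Product using (_,_)
open import Relation.Binary.PropositionalEquality using (refl; sym; trans; cong; cong₂; module ≡-Reasoning)
open import Algebra.Properties.CommutativeSemigroup +-commutativeSemigroup using (interchange)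

mutual
  pruneLeaves : Tree → List Tree
  pruneLeaves (node [])       = []
  pruneLeaves (node (t ∷ ts)) = node (pruneLeavesList (t ∷ ts)) ∷ []

  pruneLeavesList : List Tree → List Tree
  pruneLeavesList []       = []
  pruneLeavesList (t ∷ ts) = pruneLeaves t ++ pruneLeavesList ts

nodesList-++ : ∀ ts us → nodesList (ts ++ us) ≡ nodesList ts + nodesList us
nodesList-++ []       us = refl
nodesList-++ (t ∷ ts) us =
  trans (cong (nodes t +_) (nodesList-++ ts us)) (sym (+-assoc (nodes t) (nodesList ts) (nodesList us)))

mutual
  nodes≡nodes-pruneLeaves+leaves : ∀ t → nodes t ≡ nodesList (pruneLeaves t) + leaves t
  nodes≡nodes-pruneLeaves+leaves (node [])       = refl
  nodes≡nodes-pruneLeaves+leaves (node (t ∷ ts)) = cong suc (begin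
    nodesList (t ∷ ts)
      ≡⟨ nodesList≡nodesList-pruneLeavesList+leavesList (t ∷ ts) ⟩
    nodesList (pruneLeavesList (t ∷ ts)) + leavesList (t ∷ ts)
      ≡⟨ cong (_+ leavesList (t ∷ ts)) (+-identityʳ (nodesList (pruneLeavesList (t ∷ ts)))) ⟨
    nodesList (pruneLeavesList (t ∷ ts)) + 0 + leavesList (t ∷ ts) ∎)
    where open ≡-Reasoning

  nodesList≡nodesList-pruneLeavesList+leavesList : ∀ ts →
    nodesList ts ≡ nodesList (pruneLeavesList ts) + leavesList ts
  nodesList≡nodesList-pruneLeavesList+leavesList []       = refl
  nodesList≡nodesList-pruneLeavesList+leavesList (t ∷ ts) = begin
    nodes t + nodesList ts
      ≡⟨ cong₂ _+_ (nodes≡nodes-pruneLeaves+leaves t) (nodesList≡nodesList-pruneLeavesList+leavesList ts) ⟩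
    (nodesList (pruneLeaves t) + leaves t) + (nodesList (pruneLeavesList ts) + leavesList ts)
      ≡⟨ interchange (nodesList (pruneLeaves t)) (leaves t) (nodesList (pruneLeavesList ts)) (leavesList ts) ⟩
    (nodesList (pruneLeaves t) + nodesList (pruneLeavesList ts)) + (leaves t + leavesList ts)
      ≡⟨ cong (_+ (leaves t + leavesList ts)) (nodesList-++ (pruneLeaves t) (pruneLeavesList ts)) ⟨
    nodesList (pruneLeaves t ++ pruneLeavesList ts) + (leaves t + leavesList ts) ∎
    where open ≡-Reasoning

sum-filterᵇ-≤ : ∀ (p : ℕ → Bool) ns → sum (filterᵇ p ns) ≤ sum ns
sum-filterᵇ-≤ p []       = z≤n
sum-filterᵇ-≤ p (n ∷ ns) with p n
... | true  = +-monoʳ-≤ n (sum-filterᵇ-≤ p ns)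
... | false = ≤-trans (sum-filterᵇ-≤ p ns) (m≤n+m (sum ns) n)

sum-map-∸-≤ : ∀ j ns → sum (map (_∸ j) ns) ≤ sum ns
sum-map-∸-≤ j []       = z≤n
sum-map-∸-≤ j (n ∷ ns) = +-mono-≤ (m∸n≤m n j) (sum-map-∸-≤ j ns)

shift-positive : ∀ μ i j → All (1 ≤_) (shift μ i j)
shift-positive μ i j with part μ i
... | nothing = All.[]
... | just m with j <ᵇ m
...   | false = All.[]
...   | true  = All.map (<ᵇ⇒< 0 _) (all-filter (λ n → T? (0 <ᵇ n)) (map (_∸ j) (drop i μ)))

shift-dropRow : ∀ x {y μ} → All (1 ≤_) (y ∷ μ) → shift (x ∷ y ∷ μ) 1 0 ≡ y ∷ μ
shift-dropRow x {suc y} {μ} (_ ∷ μ-pos) =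
  cong (suc y ∷_) (trans (cong (filterᵇ (0 <ᵇ_)) (map-id μ)) (filter-all (λ n → T? (0 <ᵇ n)) (All.map <⇒<ᵇ μ-pos)))

sum-shift-dropColumn-< : ∀ x μ → sum (shift (suc (suc x) ∷ μ) 0 1) < sum (suc (suc x) ∷ μ)
sum-shift-dropColumn-< x μ =
  s≤s (+-monoʳ-≤ (suc x) (≤-trans (sum-filterᵇ-≤ (0 <ᵇ_) (map (_∸ 1) μ)) (sum-map-∸-≤ 1 μ)))

pruneLeaves-lctrTreeF-[] : ∀ n → pruneLeaves (lctrTreeF n []) ≡ []
pruneLeaves-lctrTreeF-[] zero    = refl
pruneLeaves-lctrTreeF-[] (suc n) = refl

-- The fuel bound matters: a tree cut off by exhausted fuel is a leaf of both
-- games' trees, but pruning would remove it only from the LCTR side.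
mutual
  pruneLeaves-lctrTreeF : ∀ {n} x μ → All (1 ≤_) (x ∷ μ) → sum (x ∷ μ) < n →
    pruneLeaves (lctrTreeF n (x ∷ μ)) ≡ downrightTreeF n (x ∷ μ) ∷ []
  pruneLeaves-lctrTreeF {suc n} x μ pos (s≤s sum≤n) = cong (λ ts → node ts ∷ [])
    (cong₂ _++_ (pruneLeaves-lctrTreeF-dropRow x μ pos sum≤n)
                (trans (++-identityʳ _) (pruneLeaves-lctrTreeF-dropColumn x μ pos sum≤n)))

  pruneLeaves-lctrTreeF-dropRow : ∀ {n} x μ → All (1 ≤_) (x ∷ μ) → sum (x ∷ μ) ≤ n →
    pruneLeaves (lctrTreeF n (shift (x ∷ μ) 1 0))
      ≡ (if 1 <ᵇ length (x ∷ μ) then downrightTreeF n (shift (x ∷ μ) 1 0) ∷ [] else [])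
  pruneLeaves-lctrTreeF-dropRow {n} x []      _              _     = pruneLeaves-lctrTreeF-[] n
  pruneLeaves-lctrTreeF-dropRow     x (y ∷ μ) (1≤x ∷ μ-pos) sum≤n rewrite shift-dropRow x μ-pos =
    pruneLeaves-lctrTreeF y μ μ-pos (<-≤-trans (m<n+m (sum (y ∷ μ)) 1≤x) sum≤n)

  pruneLeaves-lctrTreeF-dropColumn : ∀ {n} x μ → All (1 ≤_) (x ∷ μ) → sum (x ∷ μ) ≤ n →
    pruneLeaves (lctrTreeF n (shift (x ∷ μ) 0 1))
      ≡ (if 1 <ᵇ x then downrightTreeF n (shift (x ∷ μ) 0 1) ∷ [] else [])
  pruneLeaves-lctrTreeF-dropColumn     0             μ (() ∷ _) _
  pruneLeaves-lctrTreeF-dropColumn {n} 1             μ _        _     = pruneLeaves-lctrTreeF-[] n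
  pruneLeaves-lctrTreeF-dropColumn     (suc (suc x)) μ _        sum≤n =
    pruneLeaves-lctrTreeF (suc x) _ (shift-positive (suc (suc x) ∷ μ) 0 1)
      (<-≤-trans (sum-shift-dropColumn-< x μ) sum≤n)

corollary6p5 : ∀ (λ' : Partition) → IsPartition λ' → λ' ≢ [] →
    nodes (lctrTree λ') ≡ nodes (downrightTree λ') + leaves (lctrTree λ')
corollary6p5 []          _         []≢[] = ⊥-elim ([]≢[] refl)
corollary6p5 λ'@(x ∷ μ) (pos , _) _     = begin
  nodes (lctrTree λ')
    ≡⟨ nodes≡nodes-pruneLeaves+leaves (lctrTree λ') ⟩
  nodesList (pruneLeaves (lctrTree λ')) + leaves (lctrTree λ')
    ≡⟨ cong (λ ts → nodesList ts + leaves (lctrTree λ')) (pruneLeaves-lctrTreeF x μ pos (n<1+n (sum λ'))) ⟩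
  nodes (downrightTree λ') + 0 + leaves (lctrTree λ')
    ≡⟨ cong (_+ leaves (lctrTree λ')) (+-identityʳ (nodes (downrightTree λ'))) ⟩
  nodes (downrightTree λ') + leaves (lctrTree λ') ∎
  where open ≡-Reasoning
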